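{- If $D\in\mathcal{F}$, then $D$ contains the arc $c\to a$ or the arc $c\to b$.
   Context: An oriented graph is a loopless directed graph with no pair of opposite arcs. Strong diameter $2$: for every ordered pair of distinct vertices $(i,j)$ there is a directed path from $i$ to $j$ of length at most $2$. 2-connected: strong connectivity at least $2$. Paths are simple directed paths. $\mathcal{F}$ is the set of 2-connected oriented graphs $D$ with strong diameter $2$ having six distinct vertices $p,q,a,b,c,r$ such that: arcs $p\to c$, $q\to c$, $q\to b$, $b\to r$, $a\to r$, $p\to a$ are present; every directed path from $p$ to $r$ contains $a$ or contains both $c$ and $b$; every directed path from $q$ to $r$ contains $b$ or contains both $c$ and $a$; every directed path from $c$ to $r$ contains $a$ or $b$. -}

module Defs where

open import Data.Nat using (ℕ; _≥_)
open import Data.Fin using (Fin)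
open import Data.Bool using (Bool; true; false)
open import Data.List using (List; []; _∷_)
open import Data.List.Membership.Propositional using (_∈_; _∉_)
open import Data.List.Relation.Unary.Unique.Propositional using (Unique)
open import Data.Product using (Σ; _×_; ∃-syntax)
open import Data.Sum using (_⊎_)
open import Relation.Binary.PropositionalEquality using (_≡_; _≢_)

record Digraph : Set where
  field
    n   : ℕ
    arc : Fin n → Fin n → Bool

open Digraph public

module _ (D : Digraph) where

  Arc : Fin (n D) → Fin (n D) → Set
  Arc i j = arc D i j ≡ true

  Oriented : Set
  Oriented = (∀ i → arc D i i ≡ false) × (∀ i j → Arc i j → arc D j i ≡ false)

  data Walk : Fin (n D) → Fin (n D) → List (Fin (n D)) → Set where
    here : ∀ {i} → Walk i i (i ∷ [])
    step : ∀ {i j k vs} → Arc i j → Walk j k vs → Walk i k (i ∷ vs)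

  Path : Fin (n D) → Fin (n D) → List (Fin (n D)) → Set
  Path i j vs = Walk i j vs × Unique vs

  StrongDiameter≤2 : Set
  StrongDiameter≤2 = ∀ i j → i ≢ j → Arc i j ⊎ (∃[ k ] (Arc i k × Arc k j))

  Strong : Set
  Strong = ∀ i j → ∃[ vs ] Path i j vs

  -- strong connectivity at least 2: at least 3 vertices, D strong, and
  -- D - v strong for every vertex v (paths between vertices ≠ v avoiding v)
  TwoConnected : Set
  TwoConnected =
    (n D ≥ 3) × Strong ×
    (∀ v i j → i ≢ v → j ≢ v → ∃[ vs ] (Path i j vs × v ∉ vs))

  InF : (p q a b c r : Fin (n D)) → Set
  InF p q a b c r =
    Oriented × TwoConnected × StrongDiameter≤2 ×
    Unique (p ∷ q ∷ a ∷ b ∷ c ∷ r ∷ []) ×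
    (Arc p c × Arc q c × Arc q b × Arc b r × Arc a r × Arc p a) ×
    (∀ vs → Path p r vs → a ∈ vs ⊎ (c ∈ vs × b ∈ vs)) ×
    (∀ vs → Path q r vs → b ∈ vs ⊎ (c ∈ vs × a ∈ vs)) ×
    (∀ vs → Path c r vs → a ∈ vs ⊎ b ∈ vs)

  𝓕 : Set
  𝓕 = ∃[ p ] ∃[ q ] ∃[ a ] ∃[ b ] ∃[ c ] ∃[ r ] InF p q a b c r

-- Strong diameter 2 gives a path from c to r of length at most 2. It must meet a or b,
-- and neither is an endpoint, so that path is c → a → r or c → b → r.

module Submission where

open import Defs
open import Data.Fin using (Fin)
open import Data.Sum using (_⊎_; inj₁; inj₂)
open import Data.Product using (_,_; _×_; ∃-syntax)
open import Data.List using ([]; _∷_)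
open import Data.List.Membership.Propositional using (_∈_)
open import Data.List.Relation.Unary.All using ([]; _∷_)
open import Data.List.Relation.Unary.Any using (here; there)
open import Data.List.Relation.Unary.AllPairs using ([]; _∷_)
open import Data.Empty using (⊥-elim)
open import Data.Bool using (false)
open import Relation.Binary.PropositionalEquality using (_≡_; refl; _≢_; subst)

module _ (D : Digraph) where

  Loopless : Set
  Loopless = ∀ i → arc D i i ≡ false

  arc⇒≢ : Loopless → ∀ {i j} → Arc D i j → i ≢ j
  arc⇒≢ loopless {i} ij refl with subst (_≡ _) ij (loopless i)
  ... | ()

  short-path : Loopless → StrongDiameter≤2 D → ∀ {i j} → i ≢ j →
    ∃[ vs ] (Path D i j vs × (∀ {x} → x ∈ vs → x ≢ i → x ≢ j → Arc D i x))
  short-path loopless sd2 {i} {j} i≢j with sd2 i j i≢j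
  ... | inj₁ ij = i ∷ j ∷ [] , (step ij here , (i≢j ∷ []) ∷ [] ∷ []) , interior
    where
    interior : ∀ {x} → x ∈ i ∷ j ∷ [] → x ≢ i → x ≢ j → Arc D i x
    interior (here x≡i)         x≢i _   = ⊥-elim (x≢i x≡i)
    interior (there (here x≡j)) _   x≢j = ⊥-elim (x≢j x≡j)
  ... | inj₂ (k , ik , kj) =
    i ∷ k ∷ j ∷ [] ,
    (step ik (step kj here) ,
     (arc⇒≢ loopless ik ∷ i≢j ∷ []) ∷ (arc⇒≢ loopless kj ∷ []) ∷ [] ∷ []) ,
    interior
    where
    interior : ∀ {x} → x ∈ i ∷ k ∷ j ∷ [] → x ≢ i → x ≢ j → Arc D i x
    interior (here x≡i)                 x≢i _   = ⊥-elim (x≢i x≡i)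
    interior (there (here refl))        _   _   = ik
    interior (there (there (here x≡j))) _   x≢j = ⊥-elim (x≢j x≡j)

proposition11 : (D : Digraph) (p q a b c r : Fin (n D)) →
    InF D p q a b c r → Arc D c a ⊎ Arc D c b
proposition11 D p q a b c r
  ((loopless , _) , _ , sd2 ,
   (_ ∷ _ ∷ (_ ∷ a≢c ∷ a≢r ∷ []) ∷ (b≢c ∷ b≢r ∷ []) ∷ (c≢r ∷ []) ∷ [] ∷ []) ,
   _ , _ , _ , c⇝r-meets-a-or-b)
  with short-path D loopless sd2 c≢r
... | vs , c⇝r , interior with c⇝r-meets-a-or-b vs c⇝r
...   | inj₁ a∈vs = inj₁ (interior a∈vs a≢c a≢r)
...   | inj₂ b∈vs = inj₂ (interior b∈vs b≢c b≢r)
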